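{- For every non-negative integer $n$, \[ \sum_{i=0}^n\sum_{j=0}^n(-4)^{i+j}\frac{\binom{n}{i}\binom{n}{j}}{\binom{i+j}{i}}= \frac{(-3)^n(2n-1)}{4(n+1)}+\frac{4^n}{\binom{2n}{n}} \left(\frac{1}{2}-\sum_{k=0}^nC_k\left(-\frac{3}{4}\right)^{k+1}\right), \] where $C_k=\frac{1}{k+1}\binom{2k}{k}$ is the $k$th Catalan number. -}

module Defs where

open import Data.Nat as ℕ using (ℕ; zero; suc)
open import Data.Nat.Combinatorics using (_C_)
open import Data.Integer as ℤ using (ℤ)
open import Data.Rational using (ℚ; _/_; _+_; _*_; 0ℚ; 1ℚ)
open import Data.List using (List; map; sum; upTo; foldr)

-- integer / natural as a rational; the denominator is only ever applied to
-- positive numbers in the statement, the value at denominator 0 is irrelevant (0).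
frac : ℤ → ℕ → ℚ
frac a zero = 0ℚ
frac a (suc d) = a / suc d

ι : ℕ → ℚ
ι n = ℤ.+ n / 1

_^ℚ_ : ℚ → ℕ → ℚ
q ^ℚ zero = 1ℚ
q ^ℚ suc n = q * (q ^ℚ n)

sumTo : ℕ → (ℕ → ℚ) → ℚ
sumTo n f = foldr _+_ 0ℚ (map f (upTo (suc n)))

catalan : ℕ → ℚ
catalan k = frac (ℤ.+ ((2 ℕ.* k) C k)) (suc k)

module Submission where

-- Put x = −4, y = 1 + x = −3.  The factorial identity
--   C(n,i) C(n,j) C(2n,n) = C(i+j,i) · C(2n,n−i) C(n+i,n−j)
-- makes each summand a trinomial weight C(N,a) C(N−a,b) x^(N−a−b) of order
-- N = 2n at a = n−i, b = n−j, divided by C(2n,n).  Over the full square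
-- a, b ≤ N these weights sum to (1+y)^N (the library's binomial theorem, used
-- twice); they are symmetric in a, b and vanish for a + b > N, so each of the
-- two blocks outside the lower square a, b ≤ n sums to Σ_{t<n} C(2n,t) y^t.
-- Hence the left-hand side is V(n)/C(2n,n) with V(n) = (1+y)^(2n) − 2 Σ_{t<n} C(2n,t) y^t.
-- Pascal's rule gives a first-order recurrence for V; C(2n,n) times the
-- right-hand side satisfies the same recurrence (after clearing denominators, a
-- polynomial identity) and the same initial value, so they agree.

module BinomialFacts where

  open import Data.Nat
  open import Data.Nat.Properties
  open import Data.Nat.Combinatorics
    using (_C_; nCk≡n!/k![n-k]!; k![n∸k]!∣n!; k>n⇒nCk≡0; nCk≡nC[n∸k])
  open import Data.Nat.DivMod using (m/n*n≡m)
  open import Data.Nat.Solver using (module +-*-Solver)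
  open import Data.Empty using (⊥-elim)
  open import Relation.Nullary using (yes; no)
  open import Relation.Binary.PropositionalEquality
  open +-*-Solver
  open ≡-Reasoning

  C-factorial : ∀ m k → ((m + k) C k) * (k ! * m !) ≡ (m + k) !
  C-factorial m k = begin
      ((m + k) C k) * (k ! * m !)
    ≡⟨ cong (λ z → ((m + k) C k) * (k ! * z !)) (sym (m+n∸n≡m m k)) ⟩
      ((m + k) C k) * (k ! * ((m + k) ∸ k) !)
    ≡⟨ cong (_* (k ! * ((m + k) ∸ k) !)) (nCk≡n!/k![n-k]! k≤m+k) ⟩
      ((m + k) ! / (k ! * ((m + k) ∸ k) !)) {{k !* ((m + k) ∸ k) !≢0}} * (k ! * ((m + k) ∸ k) !)
    ≡⟨ m/n*n≡m {{k !* ((m + k) ∸ k) !≢0}} (k![n∸k]!∣n! k≤m+k) ⟩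
      (m + k) ! ∎
    where
    k≤m+k : k ≤ m + k
    k≤m+k = m≤n+m k m

  C-factorial′ : ∀ m k → ((m + k) C m) * (m ! * k !) ≡ (m + k) !
  C-factorial′ m k = begin
      ((m + k) C m) * (m ! * k !)   ≡⟨ cong (λ z → (z C m) * (m ! * k !)) (+-comm m k) ⟩
      ((k + m) C m) * (m ! * k !)   ≡⟨ C-factorial k m ⟩
      (k + m) !                     ≡⟨ cong _! (+-comm k m) ⟩
      (m + k) !                     ∎

  -- C(m+k, m) is positive: it is a factor of the nonzero number (m+k)!.
  C-pos : ∀ m k → 0 < (m + k) C m
  C-pos m k with (m + k) C m | C-factorial′ m k
  ... | zero  | e = ⊥-elim (<⇒≢ (>-nonZero⁻¹ ((m + k) !) {{(m + k) !≢0}}) e)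
  ... | suc _ | _ = s≤s z≤n

  factorials≢0 : ∀ a b c d → NonZero (((a ! * b !) * c !) * d !)
  factorials≢0 a b c d = m*n≢0 _ _ {{m*n≢0 _ _ {{a !* b !≢0}} {{c !≢0}}}} {{d !≢0}}

  -- With A = α+i and B = β+j, both sides equal (A+B)! / (α! i! β! j!):
  -- C(A,i) C(B,j) C(A+B,A) = C(i+j,i) C(A+B,α) C(i+B,β).
  -- This regroups the summand C(n,i) C(n,j) / C(i+j,i) of the theorem into a
  -- trinomial coefficient of order 2n.
  C-regroup : ∀ α i β j →
    (((α + i) C i) * ((β + j) C j)) * (((α + i) + (β + j)) C (α + i))
    ≡ ((i + j) C i) * ((((α + i) + (β + j)) C α) * ((i + (β + j)) C β))
  C-regroup α i β j =
    *-cancelʳ-≡ _ _ F {{factorials≢0 α i β j}} (trans lhs-F (sym rhs-F))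
    where
    A B F : ℕ
    A = α + i
    B = β + j
    F = ((α ! * i !) * β !) * j !
    lhs-F : (((A C i) * (B C j)) * ((A + B) C A)) * F ≡ (A + B) !
    lhs-F = begin
        (((A C i) * (B C j)) * ((A + B) C A)) * F
      ≡⟨ solve 7 (λ c1 c2 c3 a i b j → ((c1 :* c2) :* c3) :* (((a :* i) :* b) :* j)
                    := c3 :* ((c1 :* (i :* a)) :* (c2 :* (j :* b))))
           refl (A C i) (B C j) ((A + B) C A) (α !) (i !) (β !) (j !) ⟩
        ((A + B) C A) * (((A C i) * (i ! * α !)) * ((B C j) * (j ! * β !)))
      ≡⟨ cong₂ (λ u v → ((A + B) C A) * (u * v)) (C-factorial α i) (C-factorial β j) ⟩
        ((A + B) C A) * (A ! * B !)
      ≡⟨ C-factorial′ A B ⟩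
        (A + B) ! ∎
    iB≡ : i + B ≡ β + (i + j)
    iB≡ = solve 3 (λ i b j → i :+ (b :+ j) := b :+ (i :+ j)) refl i β j
    AB≡ : A + B ≡ α + (β + (i + j))
    AB≡ = solve 4 (λ a i b j → (a :+ i) :+ (b :+ j) := a :+ (b :+ (i :+ j))) refl α i β j
    rhs-F : (((i + j) C i) * (((A + B) C α) * ((i + B) C β))) * F ≡ (A + B) !
    rhs-F = begin
        (((i + j) C i) * (((A + B) C α) * ((i + B) C β))) * F
      ≡⟨ solve 7 (λ d1 d2 d3 a i b j → (d1 :* (d2 :* d3)) :* (((a :* i) :* b) :* j)
                    := d2 :* (a :* (d3 :* (b :* (d1 :* (i :* j))))))
           refl ((i + j) C i) ((A + B) C α) ((i + B) C β) (α !) (i !) (β !) (j !) ⟩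
        ((A + B) C α) * (α ! * (((i + B) C β) * (β ! * (((i + j) C i) * (i ! * j !)))))
      ≡⟨ cong (λ u → ((A + B) C α) * (α ! * (((i + B) C β) * (β ! * u)))) (C-factorial′ i j) ⟩
        ((A + B) C α) * (α ! * (((i + B) C β) * (β ! * (i + j) !)))
      ≡⟨ cong (λ z → ((A + B) C α) * (α ! * ((z C β) * (β ! * (i + j) !)))) iB≡ ⟩
        ((A + B) C α) * (α ! * (((β + (i + j)) C β) * (β ! * (i + j) !)))
      ≡⟨ cong (λ u → ((A + B) C α) * (α ! * u)) (C-factorial′ β (i + j)) ⟩
        ((A + B) C α) * (α ! * (β + (i + j)) !)
      ≡⟨ cong (λ z → (z C α) * (α ! * (β + (i + j)) !)) AB≡ ⟩
        ((α + (β + (i + j))) C α) * (α ! * (β + (i + j)) !)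
      ≡⟨ C-factorial′ α (β + (i + j)) ⟩
        (α + (β + (i + j))) !
      ≡⟨ cong _! (sym AB≡) ⟩
        (A + B) ! ∎

  -- Choosing a, then b out of the rest, is choosing a+b and then splitting it:
  -- the case of a set of size N = c + b + a, where both sides equal N!/(a! b! c!).
  C-subset-of-subset-fits : ∀ a b c →
    (((c + b) + a) C a) * ((c + b) C b) ≡ ((c + (a + b)) C (a + b)) * ((a + b) C a)
  C-subset-of-subset-fits a b c =
    *-cancelʳ-≡ _ _ (a ! * (b ! * c !)) {{m*n≢0 _ _ {{a !≢0}} {{b !* c !≢0}}}}
      (trans by-a-first (sym by-a+b-first))
    where
    by-a-first : ((((c + b) + a) C a) * ((c + b) C b)) * (a ! * (b ! * c !)) ≡ ((c + b) + a) !
    by-a-first = begin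
        ((((c + b) + a) C a) * ((c + b) C b)) * (a ! * (b ! * c !))
      ≡⟨ solve 5 (λ x y a b c → (x :* y) :* (a :* (b :* c)) := x :* (a :* (y :* (b :* c))))
           refl (((c + b) + a) C a) ((c + b) C b) (a !) (b !) (c !) ⟩
        (((c + b) + a) C a) * (a ! * (((c + b) C b) * (b ! * c !)))
      ≡⟨ cong (λ u → (((c + b) + a) C a) * (a ! * u)) (C-factorial c b) ⟩
        (((c + b) + a) C a) * (a ! * (c + b) !)
      ≡⟨ C-factorial (c + b) a ⟩
        ((c + b) + a) ! ∎
    by-a+b-first : (((c + (a + b)) C (a + b)) * ((a + b) C a)) * (a ! * (b ! * c !)) ≡ ((c + b) + a) !
    by-a+b-first = begin
        (((c + (a + b)) C (a + b)) * ((a + b) C a)) * (a ! * (b ! * c !))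
      ≡⟨ solve 5 (λ x y a b c → (x :* y) :* (a :* (b :* c)) := x :* ((y :* (a :* b)) :* c))
           refl ((c + (a + b)) C (a + b)) ((a + b) C a) (a !) (b !) (c !) ⟩
        ((c + (a + b)) C (a + b)) * ((((a + b) C a) * (a ! * b !)) * c !)
      ≡⟨ cong (λ u → ((c + (a + b)) C (a + b)) * (u * c !)) (C-factorial′ a b) ⟩
        ((c + (a + b)) C (a + b)) * ((a + b) ! * c !)
      ≡⟨ C-factorial c (a + b) ⟩
        (c + (a + b)) !
      ≡⟨ cong _! (solve 3 (λ a b c → c :+ (a :+ b) := (c :+ b) :+ a) refl a b c) ⟩
        ((c + b) + a) ! ∎

  C-subset-of-subset : ∀ N a b → (N C a) * ((N ∸ a) C b) ≡ (N C (a + b)) * ((a + b) C a)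
  C-subset-of-subset N a b with a + b ≤? N
  ... | yes a+b≤N = begin
      (N C a) * ((N ∸ a) C b)
    ≡⟨ cong (λ M → (M C a) * ((M ∸ a) C b)) (sym N≡) ⟩
      (((c + b) + a) C a) * ((((c + b) + a) ∸ a) C b)
    ≡⟨ cong (λ z → (((c + b) + a) C a) * (z C b)) (m+n∸n≡m (c + b) a) ⟩
      (((c + b) + a) C a) * ((c + b) C b)
    ≡⟨ C-subset-of-subset-fits a b c ⟩
      ((c + (a + b)) C (a + b)) * ((a + b) C a)
    ≡⟨ cong (λ M → (M C (a + b)) * ((a + b) C a)) (m∸n+n≡m a+b≤N) ⟩
      (N C (a + b)) * ((a + b) C a) ∎
    where
    c : ℕ
    c = N ∸ (a + b)
    N≡ : (c + b) + a ≡ N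
    N≡ = trans (+-assoc c b a) (trans (cong (c +_) (+-comm b a)) (m∸n+n≡m a+b≤N))
  ... | no a+b≰N with a ≤? N
  ...   | yes a≤N = begin
      (N C a) * ((N ∸ a) C b)         ≡⟨ cong ((N C a) *_) (k>n⇒nCk≡0 N∸a<b) ⟩
      (N C a) * 0                     ≡⟨ *-zeroʳ (N C a) ⟩
      0                               ≡⟨ cong (_* ((a + b) C a)) (k>n⇒nCk≡0 (≰⇒> a+b≰N)) ⟨
      (N C (a + b)) * ((a + b) C a)   ∎
    where
    N∸a<b : N ∸ a < b
    N∸a<b = subst (N ∸ a <_) (m+n∸m≡n a b) (∸-monoˡ-< (≰⇒> a+b≰N) a≤N)
  ...   | no a≰N = begin
      (N C a) * ((N ∸ a) C b)         ≡⟨ cong (_* ((N ∸ a) C b)) (k>n⇒nCk≡0 (≰⇒> a≰N)) ⟩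
      0                               ≡⟨ cong (_* ((a + b) C a)) (k>n⇒nCk≡0 (≰⇒> a+b≰N)) ⟨
      (N C (a + b)) * ((a + b) C a)   ∎

  C-trinomial-sym : ∀ N a b → (N C a) * ((N ∸ a) C b) ≡ (N C b) * ((N ∸ b) C a)
  C-trinomial-sym N a b = begin
      (N C a) * ((N ∸ a) C b)         ≡⟨ C-subset-of-subset N a b ⟩
      (N C (a + b)) * ((a + b) C a)   ≡⟨ cong₂ (λ s t → (N C s) * t) (+-comm a b) split-sym ⟩
      (N C (b + a)) * ((b + a) C b)   ≡⟨ C-subset-of-subset N b a ⟨
      (N C b) * ((N ∸ b) C a)         ∎
    where
    split-sym : (a + b) C a ≡ (b + a) C b
    split-sym = trans (nCk≡nC[n∸k] (m≤m+n a b))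
                  (trans (cong ((a + b) C_) (m+n∸m≡n a b)) (cong (_C b) (+-comm a b)))

  central-C-step : ∀ n → ((suc n + suc n) C suc n) * suc n ≡ ((n + n) C n) * (2 * suc (n + n))
  central-C-step n = *-cancelʳ-≡ _ _ (n ! * suc n !) {{n !* suc n !≢0}} (trans lhs (sym rhs))
    where
    lhs : (((suc n + suc n) C suc n) * suc n) * (n ! * suc n !) ≡ (suc n + suc n) !
    lhs = trans (solve 4 (λ c s f g → (c :* s) :* (f :* g) := c :* ((s :* f) :* g))
                   refl ((suc n + suc n) C suc n) (suc n) (n !) (suc n !))
                (C-factorial′ (suc n) (suc n))
    rhs : (((n + n) C n) * (2 * suc (n + n))) * (n ! * suc n !) ≡ (suc n + suc n) !
    rhs = begin
        (((n + n) C n) * (2 * suc (n + n))) * (n ! * suc n !)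
      ≡⟨ solve 3 (λ c n f → (c :* (con 2 :* (con 1 :+ (n :+ n)))) :* (f :* ((con 1 :+ n) :* f))
                    := (con 2 :+ (n :+ n)) :* ((con 1 :+ (n :+ n)) :* (c :* (f :* f))))
           refl ((n + n) C n) n (n !) ⟩
        suc (suc (n + n)) * (suc (n + n) * (((n + n) C n) * (n ! * n !)))
      ≡⟨ cong (λ u → suc (suc (n + n)) * (suc (n + n) * u)) (C-factorial′ n n) ⟩
        suc (suc (n + n)) !
      ≡⟨ cong _! (cong suc (+-suc n n)) ⟨
        (suc n + suc n) ! ∎

  C-neighbours : ∀ k m → ((suc k + m) C k) * suc m ≡ suc k * ((suc k + m) C suc k)
  C-neighbours k m = *-cancelʳ-≡ _ _ (k ! * m !) {{k !* m !≢0}} (trans lhs (sym rhs))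
    where
    N≡ : k + suc m ≡ suc k + m
    N≡ = +-suc k m
    lhs : (((suc k + m) C k) * suc m) * (k ! * m !) ≡ (suc k + m) !
    lhs = begin
        (((suc k + m) C k) * suc m) * (k ! * m !)
      ≡⟨ solve 4 (λ c s f g → (c :* s) :* (f :* g) := c :* (f :* (s :* g)))
           refl ((suc k + m) C k) (suc m) (k !) (m !) ⟩
        ((suc k + m) C k) * (k ! * suc m !)
      ≡⟨ cong (λ N → (N C k) * (k ! * suc m !)) N≡ ⟨
        ((k + suc m) C k) * (k ! * suc m !)
      ≡⟨ C-factorial′ k (suc m) ⟩
        (k + suc m) !
      ≡⟨ cong _! N≡ ⟩
        (suc k + m) ! ∎
    rhs : (suc k * ((suc k + m) C suc k)) * (k ! * m !) ≡ (suc k + m) !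
    rhs = trans (solve 4 (λ c s f g → (s :* c) :* (f :* g) := c :* ((s :* f) :* g))
                   refl ((suc k + m) C suc k) (suc k) (k !) (m !))
                (C-factorial′ (suc k) m)

  reflect-lower : ∀ n i → i ≤ n → (n + n) ∸ (n ∸ i) ≡ i + n
  reflect-lower n i i≤n = trans (cong (_∸ (n ∸ i)) (sym 2n≡)) (m+n∸m≡n (n ∸ i) (i + n))
    where
    2n≡ : (n ∸ i) + (i + n) ≡ n + n
    2n≡ = trans (sym (+-assoc (n ∸ i) i n)) (cong (_+ n) (m∸n+n≡m i≤n))

  reflect-both : ∀ n i j → i ≤ n → j ≤ n → (n + n) ∸ (n ∸ i) ∸ (n ∸ j) ≡ i + j
  reflect-both n i j i≤n j≤n =
    trans (cong (_∸ (n ∸ j)) (reflect-lower n i i≤n))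
      (trans (+-∸-assoc i (m∸n≤m n j)) (cong (i +_) (m∸[m∸n]≡n j≤n)))

  reflect-upper : ∀ n k → k < n → suc n + (n ∸ suc k) ≡ (n + n) ∸ k
  reflect-upper n k k<n = sym (trans (cong (_∸ k) (sym 2n≡)) (m+n∸n≡m (suc n + (n ∸ suc k)) k))
    where
    2n≡ : (suc n + (n ∸ suc k)) + k ≡ n + n
    2n≡ = trans (solve 3 (λ n d k → (con 1 :+ n :+ d) :+ k := n :+ (d :+ (con 1 :+ k))) refl n (n ∸ suc k) k)
                (cong (n +_) (m∸n+n≡m k<n))

  C-term-regroup : ∀ n i j → i ≤ n → j ≤ n →
    ((n C i) * (n C j)) * ((n + n) C n)
    ≡ ((i + j) C i) * (((n + n) C (n ∸ i)) * (((n + n) ∸ (n ∸ i)) C (n ∸ j)))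
  C-term-regroup n i j i≤n j≤n =
    trans (subst₂ Regrouped (m∸n+n≡m i≤n) (m∸n+n≡m j≤n) (C-regroup (n ∸ i) i (n ∸ j) j))
      (cong (λ z → ((i + j) C i) * (((n + n) C (n ∸ i)) * (z C (n ∸ j)))) (sym (reflect-lower n i i≤n)))
    where
    Regrouped : ℕ → ℕ → Set
    Regrouped A B = ((A C i) * (B C j)) * ((A + B) C A) ≡ ((i + j) C i) * (((A + B) C (n ∸ i)) * ((i + B) C (n ∸ j)))

open BinomialFacts
open import Defs
open import Data.Nat as ℕ using (ℕ; zero; suc; _<_; s≤s; _∸_)
import Data.Nat.Properties as ℕₚ
open import Data.Nat.Combinatorics using (_C_; nCk+nC[k+1]≡[n+1]C[k+1]; k>n⇒nCk≡0; nCk≡nC[n∸k])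
open import Data.Integer as ℤ using (ℤ)
import Data.Integer.Properties as ℤₚ
open import Data.Rational using (ℚ; _/_; _+_; _-_; _*_; -_; 0ℚ; 1ℚ; toℚᵘ)
import Data.Rational.Properties as ℚₚ
import Data.Rational.Unnormalised as ℚᵘ
import Data.Rational.Unnormalised.Properties as ℚᵘₚ
open import Data.Rational.Solver using (module +-*-Solver)
open import Data.List using (map; foldr; applyUpTo)
open import Data.Fin using (toℕ)
open import Function using (_∘_)
open import Relation.Binary.PropositionalEquality
  using (_≡_; refl; sym; trans; cong; cong₂; subst; module ≡-Reasoning)
open import Algebra.Bundles using (CommutativeRing; CommutativeSemiring)
open import Level using (0ℓ)
import Algebra.Properties.CommutativeSemiring.Binomial as LibraryBinomial
import Algebra.Properties.Semiring.Exp as SemiringExp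
import Algebra.Properties.Semiring.Mult as SemiringMult
import Algebra.Properties.Semiring.Sum as SemiringSum
open +-*-Solver
open ≡-Reasoning

fromℤ : ℤ → ℚ
fromℤ a = a / 1

-- The normalised fraction a/(d+1) is equivalent to its unnormalised form; this
-- moves the homomorphism proofs below to ℚᵘ, where arithmetic is componentwise.
toℚᵘ-/ : ∀ a d → toℚᵘ (a / suc d) ℚᵘ.≃ ℚᵘ.mkℚᵘ a d
toℚᵘ-/ a d = ℚₚ.toℚᵘ-fromℚᵘ (ℚᵘ.mkℚᵘ a d)

fromℤ-+ : ∀ a b → fromℤ (a ℤ.+ b) ≡ fromℤ a + fromℤ b
fromℤ-+ a b = ℚₚ.toℚᵘ-injective (ℚᵘₚ.≃-trans (toℚᵘ-/ (a ℤ.+ b) 0)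
  (ℚᵘₚ.≃-trans (ℚᵘ.*≡* cross) (ℚᵘₚ.≃-sym (ℚᵘₚ.≃-trans (ℚₚ.toℚᵘ-homo-+ (fromℤ a) (fromℤ b))
                                                   (ℚᵘₚ.+-cong (toℚᵘ-/ a 0) (toℚᵘ-/ b 0))))))
  where
  cross : (a ℤ.+ b) ℤ.* ℤ.+ 1 ≡ (a ℤ.* ℤ.+ 1 ℤ.+ b ℤ.* ℤ.+ 1) ℤ.* ℤ.+ 1
  cross = cong (ℤ._* ℤ.+ 1) (sym (cong₂ ℤ._+_ (ℤₚ.*-identityʳ a) (ℤₚ.*-identityʳ b)))

fromℤ-* : ∀ a b → fromℤ (a ℤ.* b) ≡ fromℤ a * fromℤ b
fromℤ-* a b = ℚₚ.toℚᵘ-injective (ℚᵘₚ.≃-trans (toℚᵘ-/ (a ℤ.* b) 0)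
  (ℚᵘₚ.≃-sym (ℚᵘₚ.≃-trans (ℚₚ.toℚᵘ-homo-* (fromℤ a) (fromℤ b))
                          (ℚᵘₚ.*-cong (toℚᵘ-/ a 0) (toℚᵘ-/ b 0)))))

fromℤ-neg : ∀ a → fromℤ (ℤ.- a) ≡ - fromℤ a
fromℤ-neg a = ℚₚ.toℚᵘ-injective (ℚᵘₚ.≃-trans (toℚᵘ-/ (ℤ.- a) 0)
  (ℚᵘₚ.≃-sym (ℚᵘₚ.≃-trans (ℚₚ.toℚᵘ-homo‿- (fromℤ a)) (ℚᵘₚ.-‿cong (toℚᵘ-/ a 0)))))

fromℤ-- : ∀ a b → fromℤ (a ℤ.- b) ≡ fromℤ a - fromℤ b
fromℤ-- a b = trans (fromℤ-+ a (ℤ.- b)) (cong (fromℤ a +_) (fromℤ-neg b))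

ι-+ : ∀ m n → ι (m ℕ.+ n) ≡ ι m + ι n
ι-+ m n = trans (cong fromℤ (ℤₚ.pos-+ m n)) (fromℤ-+ (ℤ.+ m) (ℤ.+ n))

ι-* : ∀ m n → ι (m ℕ.* n) ≡ ι m * ι n
ι-* m n = trans (cong fromℤ (ℤₚ.pos-* m n)) (fromℤ-* (ℤ.+ m) (ℤ.+ n))

ι-suc : ∀ m → ι (suc m) ≡ 1ℚ + ι m
ι-suc m = ι-+ 1 m

frac-cancel : ∀ a d → frac a (suc d) * ι (suc d) ≡ fromℤ a
frac-cancel a d = ℚₚ.toℚᵘ-injective (ℚᵘₚ.≃-trans (ℚₚ.toℚᵘ-homo-* (a / suc d) (ℤ.+ suc d / 1))
  (ℚᵘₚ.≃-trans (ℚᵘₚ.*-cong (toℚᵘ-/ a d) (toℚᵘ-/ (ℤ.+ suc d) 0))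
    (ℚᵘₚ.≃-trans (ℚᵘ.*≡* cross) (ℚᵘₚ.≃-sym (toℚᵘ-/ a 0)))))
  where
  cross : (a ℤ.* ℤ.+ suc d) ℤ.* ℤ.+ 1 ≡ a ℤ.* ℤ.+ (suc d ℕ.* 1)
  cross = trans (ℤₚ.*-identityʳ _) (cong (λ k → a ℤ.* ℤ.+ k) (sym (ℕₚ.*-identityʳ (suc d))))

recip : ℕ → ℚ
recip d = frac (ℤ.+ 1) d

recip-inverse : ∀ d → 0 < d → recip d * ι d ≡ 1ℚ
recip-inverse (suc d) _ = frac-cancel (ℤ.+ 1) d

*-cancelʳ-ι : ∀ p r d → p * ι (suc d) ≡ r * ι (suc d) → p ≡ r
*-cancelʳ-ι p r d e = trans (sym (undo p)) (trans (cong (_* recip (suc d)) e) (undo r))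
  where
  undo : ∀ s → (s * ι (suc d)) * recip (suc d) ≡ s
  undo s = begin
      (s * ι (suc d)) * recip (suc d)
    ≡⟨ solve 3 (λ s c i → (s :* c) :* i := s :* (i :* c)) refl s (ι (suc d)) (recip (suc d)) ⟩
      s * (recip (suc d) * ι (suc d))
    ≡⟨ cong (s *_) (recip-inverse (suc d) (s≤s ℕ.z≤n)) ⟩
      s * 1ℚ
    ≡⟨ ℚₚ.*-identityʳ s ⟩
      s ∎

*-cancelʳ-ι² : ∀ p r a b → p * (ι (suc a) * ι (suc b)) ≡ r * (ι (suc a) * ι (suc b)) → p ≡ r
*-cancelʳ-ι² p r a b e = *-cancelʳ-ι p r a (*-cancelʳ-ι (p * ι (suc a)) (r * ι (suc a)) b
  (trans (ℚₚ.*-assoc p (ι (suc a)) (ι (suc b))) (trans e (sym (ℚₚ.*-assoc r (ι (suc a)) (ι (suc b)))))))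

frac≡*recip : ∀ a d → 0 < d → frac a d ≡ fromℤ a * recip d
frac≡*recip a (suc d) _ = *-cancelʳ-ι _ _ d (begin
    frac a (suc d) * ι (suc d)                ≡⟨ frac-cancel a d ⟩
    fromℤ a                                   ≡⟨ ℚₚ.*-identityʳ (fromℤ a) ⟨
    fromℤ a * 1ℚ                              ≡⟨ cong (fromℤ a *_) (frac-cancel (ℤ.+ 1) d) ⟨
    fromℤ a * (recip (suc d) * ι (suc d))     ≡⟨ ℚₚ.*-assoc (fromℤ a) (recip (suc d)) (ι (suc d)) ⟨
    (fromℤ a * recip (suc d)) * ι (suc d)     ∎)

frac-cross : ∀ P c D K → 0 < c → 0 < D → P ℕ.* D ≡ c ℕ.* K → frac (ℤ.+ P) c ≡ recip D * ι K
frac-cross P (suc c) (suc D) K _ _ e = *-cancelʳ-ι² _ _ c D (begin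
    frac (ℤ.+ P) (suc c) * (ι (suc c) * ι (suc D))
  ≡⟨ ℚₚ.*-assoc (frac (ℤ.+ P) (suc c)) (ι (suc c)) (ι (suc D)) ⟨
    (frac (ℤ.+ P) (suc c) * ι (suc c)) * ι (suc D)
  ≡⟨ cong (_* ι (suc D)) (frac-cancel (ℤ.+ P) c) ⟩
    ι P * ι (suc D)
  ≡⟨ trans (sym (ι-* P (suc D))) (trans (cong ι e) (ι-* (suc c) K)) ⟩
    ι (suc c) * ι K
  ≡⟨ ℚₚ.*-identityˡ (ι (suc c) * ι K) ⟨
    1ℚ * (ι (suc c) * ι K)
  ≡⟨ cong (_* (ι (suc c) * ι K)) (recip-inverse (suc D) (s≤s ℕ.z≤n)) ⟨
    (recip (suc D) * ι (suc D)) * (ι (suc c) * ι K)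
  ≡⟨ solve 4 (λ i k a b → (i :* b) :* (a :* k) := (i :* k) :* (a :* b))
       refl (recip (suc D)) (ι K) (ι (suc c)) (ι (suc D)) ⟩
    (recip (suc D) * ι K) * (ι (suc c) * ι (suc D)) ∎)

^ℚ-+ : ∀ p a b → p ^ℚ (a ℕ.+ b) ≡ p ^ℚ a * p ^ℚ b
^ℚ-+ p zero    b = sym (ℚₚ.*-identityˡ (p ^ℚ b))
^ℚ-+ p (suc a) b = trans (cong (p *_) (^ℚ-+ p a b)) (sym (ℚₚ.*-assoc p (p ^ℚ a) (p ^ℚ b)))

^ℚ-* : ∀ p r k → (p * r) ^ℚ k ≡ p ^ℚ k * r ^ℚ k
^ℚ-* p r zero    = refl
^ℚ-* p r (suc k) = trans (cong ((p * r) *_) (^ℚ-* p r k))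
  (solve 4 (λ p r x y → (p :* r) :* (x :* y) := (p :* x) :* (r :* y)) refl p r (p ^ℚ k) (r ^ℚ k))

ι-^ : ∀ m k → ι (m ℕ.^ k) ≡ ι m ^ℚ k
ι-^ m zero    = refl
ι-^ m (suc k) = trans (ι-* m (m ℕ.^ k)) (cong (ι m *_) (ι-^ m k))

-- sumBelow n f = Σ_{i<n} f i.  The statement's sumTo n f = Σ_{i≤n} f i is the
-- case n+1; all manipulations of sums are done on sumBelow, by recursion on n.
sumBelow : ℕ → (ℕ → ℚ) → ℚ
sumBelow zero    f = 0ℚ
sumBelow (suc n) f = f 0 + sumBelow n (f ∘ suc)

foldr-applyUpTo : ∀ k (f : ℕ → ℚ) (g : ℕ → ℕ) →
  foldr _+_ 0ℚ (map f (applyUpTo g k)) ≡ sumBelow k (f ∘ g)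
foldr-applyUpTo zero    f g = refl
foldr-applyUpTo (suc k) f g = cong (f (g 0) +_) (foldr-applyUpTo k f (g ∘ suc))

sumTo≡sumBelow : ∀ n f → sumTo n f ≡ sumBelow (suc n) f
sumTo≡sumBelow n f = foldr-applyUpTo (suc n) f (λ i → i)

sumBelow-cong : ∀ n {f g : ℕ → ℚ} → (∀ i → i < n → f i ≡ g i) → sumBelow n f ≡ sumBelow n g
sumBelow-cong zero    f≡g = refl
sumBelow-cong (suc n) f≡g =
  cong₂ _+_ (f≡g 0 (s≤s ℕ.z≤n)) (sumBelow-cong n (λ i i<n → f≡g (suc i) (s≤s i<n)))

sumBelow-zero : ∀ n f → (∀ i → i < n → f i ≡ 0ℚ) → sumBelow n f ≡ 0ℚ
sumBelow-zero n f f≡0 = trans (sumBelow-cong n f≡0) (zeros n)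
  where
  zeros : ∀ k → sumBelow k (λ _ → 0ℚ) ≡ 0ℚ
  zeros zero    = refl
  zeros (suc k) = cong (0ℚ +_) (zeros k)

sumBelow-+ : ∀ n f g → sumBelow n (λ i → f i + g i) ≡ sumBelow n f + sumBelow n g
sumBelow-+ zero    f g = refl
sumBelow-+ (suc n) f g = trans (cong (f 0 + g 0 +_) (sumBelow-+ n (f ∘ suc) (g ∘ suc)))
  (solve 4 (λ a b c d → (a :+ b) :+ (c :+ d) := (a :+ c) :+ (b :+ d))
     refl (f 0) (g 0) (sumBelow n (f ∘ suc)) (sumBelow n (g ∘ suc)))

sumBelow-*ˡ : ∀ n c f → c * sumBelow n f ≡ sumBelow n (λ i → c * f i)
sumBelow-*ˡ zero    c f = ℚₚ.*-zeroʳ c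
sumBelow-*ˡ (suc n) c f = trans (ℚₚ.*-distribˡ-+ c (f 0) (sumBelow n (f ∘ suc)))
  (cong (c * f 0 +_) (sumBelow-*ˡ n c (f ∘ suc)))

sumBelow-last : ∀ n f → sumBelow (suc n) f ≡ sumBelow n f + f n
sumBelow-last zero    f = ℚₚ.+-comm (f 0) 0ℚ
sumBelow-last (suc n) f = trans (cong (f 0 +_) (sumBelow-last n (f ∘ suc)))
  (sym (ℚₚ.+-assoc (f 0) (sumBelow n (f ∘ suc)) (f (suc n))))

sumBelow-split : ∀ m k f → sumBelow (m ℕ.+ k) f ≡ sumBelow m f + sumBelow k (λ i → f (m ℕ.+ i))
sumBelow-split zero    k f = sym (ℚₚ.+-identityˡ (sumBelow k f))
sumBelow-split (suc m) k f = trans (cong (f 0 +_) (sumBelow-split m k (f ∘ suc)))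
  (sym (ℚₚ.+-assoc (f 0) (sumBelow m (f ∘ suc)) (sumBelow k (λ i → f (suc m ℕ.+ i)))))

sumBelow-swap : ∀ m n (f : ℕ → ℕ → ℚ) →
  sumBelow m (λ i → sumBelow n (f i)) ≡ sumBelow n (λ j → sumBelow m (λ i → f i j))
sumBelow-swap zero    n f = sym (sumBelow-zero n (λ _ → 0ℚ) (λ _ _ → refl))
sumBelow-swap (suc m) n f = trans (cong (sumBelow n (f 0) +_) (sumBelow-swap m n (f ∘ suc)))
  (sym (sumBelow-+ n (f 0) (λ j → sumBelow m (λ i → f (suc i) j))))

sumBelow-reverse : ∀ n f → sumBelow n f ≡ sumBelow n (λ i → f (n ∸ suc i))
sumBelow-reverse zero    f = refl
sumBelow-reverse (suc n) f = begin
    f 0 + sumBelow n (f ∘ suc)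
  ≡⟨ cong (f 0 +_) (sumBelow-reverse n (f ∘ suc)) ⟩
    f 0 + sumBelow n (λ i → f (suc (n ∸ suc i)))
  ≡⟨ cong (f 0 +_) (sumBelow-cong n (λ i i<n → cong f (sym (ℕₚ.+-∸-assoc 1 i<n)))) ⟩
    f 0 + sumBelow n (λ i → f (n ∸ i))
  ≡⟨ ℚₚ.+-comm (f 0) _ ⟩
    sumBelow n (λ i → f (n ∸ i)) + f 0
  ≡⟨ cong (λ k → sumBelow n (λ i → f (n ∸ i)) + f k) (ℕₚ.n∸n≡0 n) ⟨
    sumBelow n (λ i → f (n ∸ i)) + f (n ∸ n)
  ≡⟨ sumBelow-last n (λ i → f (n ∸ i)) ⟨
    sumBelow (suc n) (λ i → f (n ∸ i)) ∎

-- The binomial theorem is taken from the library, for ℚ as a commutative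
-- semiring; the lemmas below translate its sums, multiples and powers.
ℚ-semiring : CommutativeSemiring 0ℓ 0ℓ
ℚ-semiring = CommutativeRing.commutativeSemiring ℚₚ.+-*-commutativeRing

open LibraryBinomial ℚ-semiring using (binomialExpansion; theorem)
open SemiringExp (CommutativeSemiring.semiring ℚ-semiring) using (_^_)
open SemiringMult (CommutativeSemiring.semiring ℚ-semiring) using (_×_)
open SemiringSum (CommutativeSemiring.semiring ℚ-semiring) using (sum; sum-cong-≗)

sumBelow≡sum : ∀ n f → sumBelow n f ≡ sum {n} (λ i → f (toℕ i))
sumBelow≡sum zero    f = refl
sumBelow≡sum (suc n) f = cong (f 0 +_) (sumBelow≡sum n (f ∘ suc))

^ℚ≡^ : ∀ p k → p ^ℚ k ≡ p ^ k
^ℚ≡^ p zero    = refl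
^ℚ≡^ p (suc k) = cong (p *_) (^ℚ≡^ p k)

×≡ι* : ∀ k p → k × p ≡ ι k * p
×≡ι* zero    p = sym (ℚₚ.*-zeroˡ p)
×≡ι* (suc k) p = begin
    p + k × p        ≡⟨ cong (p +_) (×≡ι* k p) ⟩
    p + ι k * p      ≡⟨ solve 2 (λ p i → p :+ i :* p := (con 1ℚ :+ i) :* p) refl p (ι k) ⟩
    (1ℚ + ι k) * p   ≡⟨ cong (_* p) (ι-suc k) ⟨
    ι (suc k) * p    ∎

-- Powers of one; the library expands (1 + z)^m with a factor 1^b in each term.
1^ℚ : ∀ k → 1ℚ ^ℚ k ≡ 1ℚ
1^ℚ zero    = refl
1^ℚ (suc k) = cong (1ℚ *_) (1^ℚ k)

binomial-theorem : ∀ m z → sumBelow (suc m) (λ b → ι (m C b) * z ^ℚ (m ∸ b)) ≡ (1ℚ + z) ^ℚ m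
binomial-theorem m z = begin
    sumBelow (suc m) (λ b → ι (m C b) * z ^ℚ (m ∸ b))
  ≡⟨ sumBelow≡sum (suc m) (λ b → ι (m C b) * z ^ℚ (m ∸ b)) ⟩
    sum {suc m} (λ k → ι (m C toℕ k) * z ^ℚ (m ∸ toℕ k))
  ≡⟨ sum-cong-≗ {suc m} (λ k → library-term (toℕ k)) ⟩
    binomialExpansion 1ℚ z m
  ≡⟨ theorem m 1ℚ z ⟨
    (1ℚ + z) ^ m
  ≡⟨ ^ℚ≡^ (1ℚ + z) m ⟨
    (1ℚ + z) ^ℚ m ∎
  where
  library-term : ∀ b → ι (m C b) * z ^ℚ (m ∸ b) ≡ (m C b) × (1ℚ ^ b * z ^ (m ∸ b))
  library-term b = begin
      ι (m C b) * z ^ℚ (m ∸ b)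
    ≡⟨ cong (ι (m C b) *_) (ℚₚ.*-identityˡ (z ^ℚ (m ∸ b))) ⟨
      ι (m C b) * (1ℚ * z ^ℚ (m ∸ b))
    ≡⟨ cong (λ u → ι (m C b) * (u * z ^ℚ (m ∸ b))) (1^ℚ b) ⟨
      ι (m C b) * (1ℚ ^ℚ b * z ^ℚ (m ∸ b))
    ≡⟨ cong₂ (λ u v → ι (m C b) * (u * v)) (^ℚ≡^ 1ℚ b) (^ℚ≡^ z (m ∸ b)) ⟩
      ι (m C b) * (1ℚ ^ b * z ^ (m ∸ b))
    ≡⟨ ×≡ι* (m C b) (1ℚ ^ b * z ^ (m ∸ b)) ⟨
      (m C b) × (1ℚ ^ b * z ^ (m ∸ b)) ∎

-- The trinomial weight C(N,a) C(N−a,b) x^(N−a−b) = N!/(a! b! (N−a−b)!) · x^(N−a−b);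
-- it vanishes for a + b > N, and the weights of order N sum to (1 + 1 + x)^N.
trinomial : ℚ → ℕ → ℕ → ℕ → ℚ
trinomial x N a b = ι ((N C a) ℕ.* ((N ∸ a) C b)) * x ^ℚ (N ∸ a ∸ b)

binomialRow : ℚ → ℕ → ℕ → ℚ
binomialRow z N a = ι (N C a) * z ^ℚ (N ∸ a)

trinomial-sym : ∀ x N a b → trinomial x N a b ≡ trinomial x N b a
trinomial-sym x N a b = cong₂ (λ k e → ι k * x ^ℚ e) (C-trinomial-sym N a b) exponent-sym
  where
  exponent-sym : N ∸ a ∸ b ≡ N ∸ b ∸ a
  exponent-sym = trans (ℕₚ.∸-+-assoc N a b) (trans (cong (N ∸_) (ℕₚ.+-comm a b)) (sym (ℕₚ.∸-+-assoc N b a)))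

trinomial-row : ∀ x N a L → N ∸ a < L → sumBelow L (trinomial x N a) ≡ binomialRow (1ℚ + x) N a
trinomial-row x N a L N∸a<L = begin
    sumBelow L (trinomial x N a)
  ≡⟨ cong (λ L → sumBelow L (trinomial x N a)) L≡ ⟨
    sumBelow (suc m ℕ.+ k) (trinomial x N a)
  ≡⟨ sumBelow-split (suc m) k (trinomial x N a) ⟩
    sumBelow (suc m) (trinomial x N a) + sumBelow k (λ i → trinomial x N a (suc m ℕ.+ i))
  ≡⟨ cong₂ _+_ in-range (sumBelow-zero k _ (λ i _ → beyond-range i)) ⟩
    binomialRow (1ℚ + x) N a + 0ℚ
  ≡⟨ ℚₚ.+-identityʳ _ ⟩
    binomialRow (1ℚ + x) N a ∎
  where
  m : ℕ
  m = N ∸ a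
  k : ℕ
  k = L ∸ suc m
  L≡ : suc m ℕ.+ k ≡ L
  L≡ = ℕₚ.m+[n∸m]≡n N∸a<L
  beyond-range : ∀ i → trinomial x N a (suc m ℕ.+ i) ≡ 0ℚ
  beyond-range i = begin
      ι ((N C a) ℕ.* (m C (suc m ℕ.+ i))) * x ^ℚ (m ∸ (suc m ℕ.+ i))
    ≡⟨ cong (λ c → ι ((N C a) ℕ.* c) * x ^ℚ (m ∸ (suc m ℕ.+ i))) (k>n⇒nCk≡0 (ℕₚ.m≤m+n (suc m) i)) ⟩
      ι ((N C a) ℕ.* 0) * x ^ℚ (m ∸ (suc m ℕ.+ i))
    ≡⟨ cong (λ c → ι c * x ^ℚ (m ∸ (suc m ℕ.+ i))) (ℕₚ.*-zeroʳ (N C a)) ⟩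
      0ℚ * x ^ℚ (m ∸ (suc m ℕ.+ i))
    ≡⟨ ℚₚ.*-zeroˡ (x ^ℚ (m ∸ (suc m ℕ.+ i))) ⟩
      0ℚ ∎
  in-range : sumBelow (suc m) (trinomial x N a) ≡ binomialRow (1ℚ + x) N a
  in-range = begin
      sumBelow (suc m) (trinomial x N a)
    ≡⟨ sumBelow-cong (suc m) (λ b _ → trans (cong (_* x ^ℚ (m ∸ b)) (ι-* (N C a) (m C b)))
                                           (ℚₚ.*-assoc (ι (N C a)) (ι (m C b)) (x ^ℚ (m ∸ b)))) ⟩
      sumBelow (suc m) (λ b → ι (N C a) * (ι (m C b) * x ^ℚ (m ∸ b)))
    ≡⟨ sumBelow-*ˡ (suc m) (ι (N C a)) (λ b → ι (m C b) * x ^ℚ (m ∸ b)) ⟨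
      ι (N C a) * sumBelow (suc m) (λ b → ι (m C b) * x ^ℚ (m ∸ b))
    ≡⟨ cong (ι (N C a) *_) (binomial-theorem m x) ⟩
      binomialRow (1ℚ + x) N a ∎

trinomial-square : ∀ x N →
  sumBelow (suc N) (λ a → sumBelow (suc N) (trinomial x N a)) ≡ (1ℚ + (1ℚ + x)) ^ℚ N
trinomial-square x N = begin
    sumBelow (suc N) (λ a → sumBelow (suc N) (trinomial x N a))
  ≡⟨ sumBelow-cong (suc N) (λ a _ → trinomial-row x N a (suc N) (s≤s (ℕₚ.m∸n≤m N a))) ⟩
    sumBelow (suc N) (binomialRow (1ℚ + x) N)
  ≡⟨ binomial-theorem N (1ℚ + x) ⟩
    (1ℚ + (1ℚ + x)) ^ℚ N ∎

-- The weights of order 2n with a, b ≤ n; up to the factor C(2n,n) and the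
-- reflections a = n − i, b = n − j this is the double sum of the theorem.
lowerSquare : ℚ → ℕ → ℚ
lowerSquare x n = sumBelow (suc n) (λ a → sumBelow (suc n) (trinomial x (n ℕ.+ n) a))

upperRows : ℚ → ℕ → ℚ
upperRows z n = sumBelow n (λ k → binomialRow z (n ℕ.+ n) (suc n ℕ.+ k))

upper-block : ∀ x n →
  sumBelow n (λ k → sumBelow (suc (n ℕ.+ n)) (trinomial x (n ℕ.+ n) (suc n ℕ.+ k)))
  ≡ upperRows (1ℚ + x) n
upper-block x n = sumBelow-cong n (λ k _ →
  trinomial-row x (n ℕ.+ n) (suc n ℕ.+ k) (suc (n ℕ.+ n)) (s≤s (ℕₚ.m∸n≤m (n ℕ.+ n) (suc n ℕ.+ k))))

-- The block a ≤ n < b is the transpose of the block a > n, b ≤ n; the latter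
-- already contains the whole support b ≤ 2n − a < n of its rows.
mixed-block : ∀ x n →
  sumBelow (suc n) (λ a → sumBelow n (λ k → trinomial x (n ℕ.+ n) a (suc n ℕ.+ k)))
  ≡ upperRows (1ℚ + x) n
mixed-block x n = begin
    sumBelow (suc n) (λ a → sumBelow n (λ k → trinomial x N a (suc n ℕ.+ k)))
  ≡⟨ sumBelow-swap (suc n) n (λ a k → trinomial x N a (suc n ℕ.+ k)) ⟩
    sumBelow n (λ k → sumBelow (suc n) (λ a → trinomial x N a (suc n ℕ.+ k)))
  ≡⟨ sumBelow-cong n (λ k _ → sumBelow-cong (suc n) (λ a _ → trinomial-sym x N a (suc n ℕ.+ k))) ⟩
    sumBelow n (λ k → sumBelow (suc n) (trinomial x N (suc n ℕ.+ k)))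
  ≡⟨ sumBelow-cong n (λ k _ → trinomial-row x N (suc n ℕ.+ k) (suc n) (row-support k)) ⟩
    upperRows (1ℚ + x) n ∎
  where
  N : ℕ
  N = n ℕ.+ n
  row-support : ∀ k → N ∸ (suc n ℕ.+ k) < suc n
  row-support k = s≤s (ℕₚ.≤-trans (ℕₚ.∸-monoʳ-≤ N (ℕₚ.≤-trans (ℕₚ.n≤1+n n) (ℕₚ.m≤m+n (suc n) k)))
                                  (ℕₚ.≤-reflexive (ℕₚ.m+n∸m≡n n n)))

lowerSquare-decomposition : ∀ x n →
  lowerSquare x n ≡ (1ℚ + (1ℚ + x)) ^ℚ (n ℕ.+ n) - (upperRows (1ℚ + x) n + upperRows (1ℚ + x) n)
lowerSquare-decomposition x n = begin
    lowerSquare x n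
  ≡⟨ solve 2 (λ s u → s := ((s :+ u) :+ u) :- (u :+ u)) refl (lowerSquare x n) U ⟩
    ((lowerSquare x n + U) + U) - (U + U)
  ≡⟨ cong (_- (U + U)) blocks ⟩
    (1ℚ + (1ℚ + x)) ^ℚ N - (U + U) ∎
  where
  N : ℕ
  N = n ℕ.+ n
  U : ℚ
  U = upperRows (1ℚ + x) n
  mixed upper : ℚ
  mixed = sumBelow (suc n) (λ a → sumBelow n (λ k → trinomial x N a (suc n ℕ.+ k)))
  upper = sumBelow n (λ k → sumBelow (suc N) (trinomial x N (suc n ℕ.+ k)))
  blocks : (lowerSquare x n + U) + U ≡ (1ℚ + (1ℚ + x)) ^ℚ N
  blocks = begin
      (lowerSquare x n + U) + U
    ≡⟨ cong₂ (λ u v → (lowerSquare x n + u) + v) (mixed-block x n) (upper-block x n) ⟨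
      (lowerSquare x n + mixed) + upper
    ≡⟨ cong (_+ upper) (sumBelow-+ (suc n) (λ a → sumBelow (suc n) (trinomial x N a))
                                           (λ a → sumBelow n (λ k → trinomial x N a (suc n ℕ.+ k)))) ⟨
      sumBelow (suc n) (λ a → sumBelow (suc n) (trinomial x N a) + sumBelow n (λ k → trinomial x N a (suc n ℕ.+ k)))
        + upper
    ≡⟨ cong (_+ upper) (sumBelow-cong (suc n) (λ a _ → sumBelow-split (suc n) n (trinomial x N a))) ⟨
      sumBelow (suc n) (λ a → sumBelow (suc N) (trinomial x N a)) + upper
    ≡⟨ sumBelow-split (suc n) n (λ a → sumBelow (suc N) (trinomial x N a)) ⟨
      sumBelow (suc N) (λ a → sumBelow (suc N) (trinomial x N a))
    ≡⟨ trinomial-square x N ⟩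
      (1ℚ + (1ℚ + x)) ^ℚ N ∎

partialRow : ℚ → ℕ → ℕ → ℚ
partialRow z m k = sumBelow k (λ t → ι (m C t) * z ^ℚ t)

-- Reflecting a = 2n − t turns the upper rows into the first n terms of (1+z)^(2n).
upperRows≡partialRow : ∀ z n → upperRows z n ≡ partialRow z (n ℕ.+ n) n
upperRows≡partialRow z n =
  trans (sumBelow-reverse n (λ k → binomialRow z N (suc n ℕ.+ k))) (sumBelow-cong n reflected)
  where
  N : ℕ
  N = n ℕ.+ n
  reflected : ∀ k → k < n → binomialRow z N (suc n ℕ.+ (n ∸ suc k)) ≡ ι (N C k) * z ^ℚ k
  reflected k k<n = trans (cong (binomialRow z N) (reflect-upper n k k<n))
    (cong₂ (λ c e → ι c * z ^ℚ e) (sym (nCk≡nC[n∸k] k≤N)) (ℕₚ.m∸[m∸n]≡n k≤N))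
    where
    k≤N : k ℕ.≤ N
    k≤N = ℕₚ.≤-trans (ℕₚ.<⇒≤ k<n) (ℕₚ.m≤m+n n n)

lowerSquareValue : ℚ → ℕ → ℚ
lowerSquareValue z n = (1ℚ + z) ^ℚ (n ℕ.+ n) - (partialRow z (n ℕ.+ n) n + partialRow z (n ℕ.+ n) n)

lowerSquare-closedForm : ∀ x n → lowerSquare x n ≡ lowerSquareValue (1ℚ + x) n
lowerSquare-closedForm x n = trans (lowerSquare-decomposition x n)
  (cong (λ u → (1ℚ + (1ℚ + x)) ^ℚ (n ℕ.+ n) - (u + u)) (upperRows≡partialRow (1ℚ + x) n))

partialRow-pascal : ∀ z m k → partialRow z (suc m) (suc k) ≡ partialRow z m (suc k) + z * partialRow z m k
partialRow-pascal z m k = begin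
    partialRow z (suc m) (suc k)
  ≡⟨⟩
    ι (m C 0) * 1ℚ + sumBelow k (λ t → ι (suc m C suc t) * z ^ℚ suc t)
  ≡⟨ cong (ι (m C 0) * 1ℚ +_) (trans (sumBelow-cong k pascal)
       (sumBelow-+ k (λ t → z * (ι (m C t) * z ^ℚ t)) (λ t → ι (m C suc t) * z ^ℚ suc t))) ⟩
    ι (m C 0) * 1ℚ + (sumBelow k (λ t → z * (ι (m C t) * z ^ℚ t)) + rest)
  ≡⟨ cong (λ u → ι (m C 0) * 1ℚ + (u + rest)) (sumBelow-*ˡ k z (λ t → ι (m C t) * z ^ℚ t)) ⟨
    ι (m C 0) * 1ℚ + (z * partialRow z m k + rest)
  ≡⟨ solve 3 (λ a u b → a :+ (u :+ b) := (a :+ b) :+ u) refl (ι (m C 0) * 1ℚ) (z * partialRow z m k) rest ⟩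
    (ι (m C 0) * 1ℚ + rest) + z * partialRow z m k
  ≡⟨⟩
    partialRow z m (suc k) + z * partialRow z m k ∎
  where
  rest : ℚ
  rest = sumBelow k (λ t → ι (m C suc t) * z ^ℚ suc t)
  pascal : ∀ t → t < k → ι (suc m C suc t) * z ^ℚ suc t ≡ z * (ι (m C t) * z ^ℚ t) + ι (m C suc t) * z ^ℚ suc t
  pascal t _ = begin
      ι (suc m C suc t) * z ^ℚ suc t
    ≡⟨ cong (λ c → ι c * z ^ℚ suc t) (nCk+nC[k+1]≡[n+1]C[k+1] m t) ⟨
      ι ((m C t) ℕ.+ (m C suc t)) * z ^ℚ suc t
    ≡⟨ cong (_* z ^ℚ suc t) (ι-+ (m C t) (m C suc t)) ⟩
      (ι (m C t) + ι (m C suc t)) * (z * z ^ℚ t)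
    ≡⟨ solve 4 (λ a b z w → (a :+ b) :* (z :* w) := z :* (a :* w) :+ b :* (z :* w))
         refl (ι (m C t)) (ι (m C suc t)) z (z ^ℚ t) ⟩
      z * (ι (m C t) * z ^ℚ t) + ι (m C suc t) * z ^ℚ suc t ∎

belowCentral : ℕ → ℕ
belowCentral zero    = 0
belowCentral (suc n) = (suc n ℕ.+ suc n) C n

-- Passing from row 2n to row 2n+1 with n terms: the Pascal recursion
-- overshoots by the last term C(2n, n−1) z^n.
partialRow-odd : ∀ z n →
  partialRow z (suc (n ℕ.+ n)) n
  ≡ partialRow z (n ℕ.+ n) n + z * partialRow z (n ℕ.+ n) n - ι (belowCentral n) * z ^ℚ n
partialRow-odd z zero    = solve 1 (λ z → con 0ℚ := con 0ℚ :+ z :* con 0ℚ :- con 0ℚ :* con 1ℚ) refl z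
partialRow-odd z (suc n) = begin
    partialRow z (suc N) (suc n)
  ≡⟨ partialRow-pascal z N n ⟩
    partialRow z N (suc n) + z * partialRow z N n
  ≡⟨ cong (_+ z * partialRow z N n) (sumBelow-last n (λ t → ι (N C t) * z ^ℚ t)) ⟩
    (partialRow z N n + c * z ^ℚ n) + z * partialRow z N n
  ≡⟨ solve 4 (λ d c w z → (d :+ c :* w) :+ z :* d := ((d :+ c :* w) :+ z :* (d :+ c :* w)) :- c :* (z :* w))
       refl (partialRow z N n) c (z ^ℚ n) z ⟩
    (partialRow z N n + c * z ^ℚ n) + z * (partialRow z N n + c * z ^ℚ n) - c * (z * z ^ℚ n)
  ≡⟨ cong (λ u → u + z * u - c * (z * z ^ℚ n)) (sumBelow-last n (λ t → ι (N C t) * z ^ℚ t)) ⟨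
    partialRow z N (suc n) + z * partialRow z N (suc n) - c * (z * z ^ℚ n) ∎
  where
  N : ℕ
  N = suc n ℕ.+ suc n
  c : ℚ
  c = ι (N C n)

partialRow-central-step : ∀ z n →
  partialRow z (suc n ℕ.+ suc n) (suc n)
  ≡ (1ℚ + z) * (1ℚ + z) * partialRow z (n ℕ.+ n) n
    + z ^ℚ n * (ι ((n ℕ.+ n) C n) - z * ι (belowCentral n))
partialRow-central-step z n = begin
    partialRow z (suc n ℕ.+ suc n) (suc n)
  ≡⟨ cong (λ L → partialRow z L (suc n)) (cong suc (ℕₚ.+-suc n n)) ⟩
    partialRow z (suc (suc N)) (suc n)
  ≡⟨ partialRow-pascal z (suc N) n ⟩
    partialRow z (suc N) (suc n) + z * partialRow z (suc N) n
  ≡⟨ cong₂ (λ u v → u + z * v)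
       (trans (partialRow-pascal z N n) (cong (_+ z * D) (sumBelow-last n (λ t → ι (N C t) * z ^ℚ t))))
       (partialRow-odd z n) ⟩
    ((D + c * zⁿ) + z * D) + z * (D + z * D - cq * zⁿ)
  ≡⟨ solve 5 (λ d c w q z → ((d :+ c :* w) :+ z :* d) :+ z :* (d :+ z :* d :- q :* w)
                 := (con 1ℚ :+ z) :* (con 1ℚ :+ z) :* d :+ w :* (c :- z :* q))
       refl D c zⁿ cq z ⟩
    (1ℚ + z) * (1ℚ + z) * D + zⁿ * (c - z * cq) ∎
  where
  N : ℕ
  N = n ℕ.+ n
  D c cq zⁿ : ℚ
  D = partialRow z N n
  c = ι (N C n)
  cq = ι (belowCentral n)
  zⁿ = z ^ℚ n

lowerSquareValue-step : ∀ z n →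
  lowerSquareValue z (suc n)
  ≡ (1ℚ + z) * (1ℚ + z) * lowerSquareValue z n
    - (z ^ℚ n + z ^ℚ n) * (ι ((n ℕ.+ n) C n) - z * ι (belowCentral n))
lowerSquareValue-step z n = begin
    lowerSquareValue z (suc n)
  ≡⟨⟩
    (1ℚ + z) ^ℚ (suc n ℕ.+ suc n) - (D₁ + D₁)
  ≡⟨ cong₂ (λ u v → u - (v + v)) (cong ((1ℚ + z) ^ℚ_) (cong suc (ℕₚ.+-suc n n))) (partialRow-central-step z n) ⟩
    (1ℚ + z) * ((1ℚ + z) * W) - (((1ℚ + z) * (1ℚ + z) * D + zⁿ * e) + ((1ℚ + z) * (1ℚ + z) * D + zⁿ * e))
  ≡⟨ solve 5 (λ w d p e z → (con 1ℚ :+ z) :* ((con 1ℚ :+ z) :* w)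
                 :- (((con 1ℚ :+ z) :* (con 1ℚ :+ z) :* d :+ p :* e) :+ ((con 1ℚ :+ z) :* (con 1ℚ :+ z) :* d :+ p :* e))
                 := (con 1ℚ :+ z) :* (con 1ℚ :+ z) :* (w :- (d :+ d)) :- (p :+ p) :* e)
       refl W D zⁿ e z ⟩
    (1ℚ + z) * (1ℚ + z) * (W - (D + D)) - (zⁿ + zⁿ) * e
  ≡⟨⟩
    (1ℚ + z) * (1ℚ + z) * lowerSquareValue z n - (zⁿ + zⁿ) * e ∎
  where
  N : ℕ
  N = n ℕ.+ n
  D₁ W D zⁿ e : ℚ
  D₁ = partialRow z (suc n ℕ.+ suc n) (suc n)
  W = (1ℚ + z) ^ℚ N
  D = partialRow z N n
  zⁿ = z ^ℚ n
  e = ι (N C n) - z * ι (belowCentral n)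

-- The constants of the theorem: x = −4 in the double sum, y = 1 + x = −3 and
-- q = y/4 = −3/4 on the right-hand side.
x y q four two quarter : ℚ
x = fromℤ (ℤ.- ℤ.+ 4)
y = (ℤ.- ℤ.+ 3) / 1
q = (ℤ.- ℤ.+ 3) / 4
four = fromℤ (ℤ.+ 4)
two = fromℤ (ℤ.+ 2)
quarter = ℤ.+ 1 / 4

firstTermCoeff : ℕ → ℚ
firstTermCoeff n = frac (ℤ.+ (2 ℕ.* n) ℤ.- ℤ.+ 1) (4 ℕ.* (n ℕ.+ 1))

catalanTail : ℕ → ℚ
catalanTail n = (ℤ.+ 1 / 2) - sumTo n (λ k → catalan k * q ^ℚ (k ℕ.+ 1))

-- The right-hand side multiplied by C(2n,n).
scaledRHS : ℕ → ℚ
scaledRHS n = ι ((n ℕ.+ n) C n) * (y ^ℚ n * firstTermCoeff n) + ι (4 ℕ.^ n) * catalanTail n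

catalanTail-step : ∀ n → catalanTail (suc n) ≡ catalanTail n - catalan (suc n) * q ^ℚ (suc n ℕ.+ 1)
catalanTail-step n = begin
    catalanTail (suc n)
  ≡⟨⟩
    half - sumTo (suc n) term
  ≡⟨ cong (λ s → half - s) (trans (sumTo≡sumBelow (suc n) term)
       (trans (sumBelow-last (suc n) term) (cong (_+ term (suc n)) (sym (sumTo≡sumBelow n term))))) ⟩
    half - (sumTo n term + term (suc n))
  ≡⟨ solve 3 (λ a s t → a :- (s :+ t) := (a :- s) :- t) refl half (sumTo n term) (term (suc n)) ⟩
    (half - sumTo n term) - term (suc n) ∎
  where
  half : ℚ
  half = ℤ.+ 1 / 2
  term : ℕ → ℚ
  term k = catalan k * q ^ℚ (k ℕ.+ 1)

firstTermCoeff-clear : ∀ k → firstTermCoeff k * (1ℚ + ι k) ≡ quarter * (two * ι k - 1ℚ)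
firstTermCoeff-clear k = begin
    g * (1ℚ + ι k)
  ≡⟨ cong (g *_) (ι-suc k) ⟨
    g * ι (suc k)
  ≡⟨ solve 2 (λ g i → g :* i := con quarter :* (g :* (con four :* i))) refl g (ι (suc k)) ⟩
    quarter * (g * (four * ι (suc k)))
  ≡⟨ cong (quarter *_) denominator ⟩
    quarter * fromℤ (ℤ.+ (2 ℕ.* k) ℤ.- ℤ.+ 1)
  ≡⟨ cong (quarter *_) (trans (fromℤ-- (ℤ.+ (2 ℕ.* k)) (ℤ.+ 1)) (cong (_- 1ℚ) (ι-* 2 k))) ⟩
    quarter * (two * ι k - 1ℚ) ∎
  where
  g : ℚ
  g = firstTermCoeff k
  denominator : g * (four * ι (suc k)) ≡ fromℤ (ℤ.+ (2 ℕ.* k) ℤ.- ℤ.+ 1)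
  denominator = begin
      g * (four * ι (suc k))
    ≡⟨ cong₂ (λ d u → frac (ℤ.+ (2 ℕ.* k) ℤ.- ℤ.+ 1) (4 ℕ.* d) * u) (ℕₚ.+-comm k 1) (sym (ι-* 4 (suc k))) ⟩
      frac (ℤ.+ (2 ℕ.* k) ℤ.- ℤ.+ 1) (4 ℕ.* suc k) * ι (4 ℕ.* suc k)
    ≡⟨ frac-cancel (ℤ.+ (2 ℕ.* k) ℤ.- ℤ.+ 1) _ ⟩
      fromℤ (ℤ.+ (2 ℕ.* k) ℤ.- ℤ.+ 1) ∎

central-clear : ∀ n →
  ι ((suc n ℕ.+ suc n) C suc n) * (1ℚ + ι n) ≡ ι ((n ℕ.+ n) C n) * (two * (1ℚ + (ι n + ι n)))
central-clear n = begin
    ι ((suc n ℕ.+ suc n) C suc n) * (1ℚ + ι n)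
  ≡⟨ cong (ι ((suc n ℕ.+ suc n) C suc n) *_) (ι-suc n) ⟨
    ι ((suc n ℕ.+ suc n) C suc n) * ι (suc n)
  ≡⟨ trans (sym (ι-* ((suc n ℕ.+ suc n) C suc n) (suc n))) (cong ι (central-C-step n)) ⟩
    ι (((n ℕ.+ n) C n) ℕ.* (2 ℕ.* suc (n ℕ.+ n)))
  ≡⟨ trans (ι-* ((n ℕ.+ n) C n) _) (cong (ι ((n ℕ.+ n) C n) *_) (ι-* 2 (suc (n ℕ.+ n)))) ⟩
    ι ((n ℕ.+ n) C n) * (two * ι (suc (n ℕ.+ n)))
  ≡⟨ cong (λ u → ι ((n ℕ.+ n) C n) * (two * u)) (trans (ι-suc (n ℕ.+ n)) (cong (1ℚ +_) (ι-+ n n))) ⟩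
    ι ((n ℕ.+ n) C n) * (two * (1ℚ + (ι n + ι n))) ∎

ι-suc-suc : ∀ n → ι (suc (suc n)) ≡ 1ℚ + (1ℚ + ι n)
ι-suc-suc n = trans (ι-suc (suc n)) (cong (1ℚ +_) (ι-suc n))

catalan-clear : ∀ n → catalan (suc n) * (1ℚ + (1ℚ + ι n)) ≡ ι ((suc n ℕ.+ suc n) C suc n)
catalan-clear n = begin
    catalan (suc n) * (1ℚ + (1ℚ + ι n))
  ≡⟨ cong (catalan (suc n) *_) (ι-suc-suc n) ⟨
    catalan (suc n) * ι (suc (suc n))
  ≡⟨ frac-cancel (ℤ.+ ((2 ℕ.* suc n) C suc n)) (suc n) ⟩
    ι ((2 ℕ.* suc n) C suc n)
  ≡⟨ cong (λ k → ι (k C suc n)) (cong (suc n ℕ.+_) (ℕₚ.+-identityʳ (suc n))) ⟩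
    ι ((suc n ℕ.+ suc n) C suc n) ∎

belowCentral-clear : ∀ n → ι (belowCentral n) * (1ℚ + ι n) ≡ ι n * ι ((n ℕ.+ n) C n)
belowCentral-clear zero    = refl
belowCentral-clear (suc n) = begin
    ι ((suc n ℕ.+ suc n) C n) * (1ℚ + ι (suc n))
  ≡⟨ cong (ι ((suc n ℕ.+ suc n) C n) *_) (ι-suc (suc n)) ⟨
    ι ((suc n ℕ.+ suc n) C n) * ι (suc (suc n))
  ≡⟨ trans (sym (ι-* ((suc n ℕ.+ suc n) C n) (suc (suc n)))) (cong ι (C-neighbours n (suc n))) ⟩
    ι (suc n ℕ.* ((suc n ℕ.+ suc n) C suc n))
  ≡⟨ ι-* (suc n) ((suc n ℕ.+ suc n) C suc n) ⟩
    ι (suc n) * ι ((suc n ℕ.+ suc n) C suc n) ∎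

-- 4^(n+1) q^(n+2) = y^n · yq, since 4q = y.
power-q : ∀ n → ι (4 ℕ.^ suc n) * q ^ℚ (suc n ℕ.+ 1) ≡ y ^ℚ n * (y * q)
power-q n = begin
    ι (4 ℕ.^ suc n) * q ^ℚ (suc n ℕ.+ 1)
  ≡⟨ cong₂ _*_ (ι-^ 4 (suc n)) (^ℚ-+ q (suc n) 1) ⟩
    four ^ℚ suc n * (q ^ℚ suc n * (q * 1ℚ))
  ≡⟨ solve 3 (λ a b q → a :* (b :* (q :* con 1ℚ)) := (a :* b) :* q) refl (four ^ℚ suc n) (q ^ℚ suc n) q ⟩
    (four ^ℚ suc n * q ^ℚ suc n) * q
  ≡⟨ cong (_* q) (^ℚ-* four q (suc n)) ⟨
    (y * y ^ℚ n) * q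
  ≡⟨ solve 2 (λ w q → (con y :* w) :* q := w :* (con y :* q)) refl (y ^ℚ n) q ⟩
    y ^ℚ n * (y * q) ∎

-- After clearing the denominators (n+1)(n+2), the recurrence for the scaled
-- right-hand side is a polynomial identity in m = n and c = C(2n,n).
recurrence-core : ∀ (m c c₁ cat₁ cq g₀ g₁ : ℚ) →
  c₁ * (1ℚ + m) ≡ c * (two * (1ℚ + (m + m))) →
  cat₁ * (1ℚ + (1ℚ + m)) ≡ c₁ →
  cq * (1ℚ + m) ≡ m * c →
  g₀ * (1ℚ + m) ≡ quarter * (two * m - 1ℚ) →
  g₁ * (1ℚ + (1ℚ + m)) ≡ quarter * (two * (1ℚ + m) - 1ℚ) →
  (c₁ * (y * g₁) - (y * q) * cat₁) * ((1ℚ + m) * (1ℚ + (1ℚ + m)))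
  ≡ (four * (c * g₀) - two * (c - y * cq)) * ((1ℚ + m) * (1ℚ + (1ℚ + m)))
recurrence-core m c c₁ cat₁ cq g₀ g₁ central catalan below coeff₀ coeff₁ = begin
    (c₁ * (y * g₁) - (y * q) * cat₁) * (m₁ * m₂)
  ≡⟨ solve 5 (λ c₁ g₁ cat₁ m₁ m₂ → (c₁ :* (con y :* g₁) :- (con y :* con q) :* cat₁) :* (m₁ :* m₂)
                 := con y :* (c₁ :* m₁) :* (g₁ :* m₂) :- (con y :* con q) :* ((cat₁ :* m₂) :* m₁))
       refl c₁ g₁ cat₁ m₁ m₂ ⟩
    y * (c₁ * m₁) * (g₁ * m₂) - (y * q) * ((cat₁ * m₂) * m₁)
  ≡⟨ cong (λ u → y * (c₁ * m₁) * (g₁ * m₂) - (y * q) * (u * m₁)) catalan ⟩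
    y * (c₁ * m₁) * (g₁ * m₂) - (y * q) * (c₁ * m₁)
  ≡⟨ cong₂ (λ u v → y * u * v - (y * q) * u) central coeff₁ ⟩
    y * c₂ * (quarter * (two * m₁ - 1ℚ)) - (y * q) * c₂
  ≡⟨ solve 2 (λ c m → con y :* (c :* (con two :* (con 1ℚ :+ (m :+ m)))) :* (con quarter :* (con two :* (con 1ℚ :+ m) :- con 1ℚ))
                        :- (con y :* con q) :* (c :* (con two :* (con 1ℚ :+ (m :+ m))))
                 := (con four :* c :* (con quarter :* (con two :* m :- con 1ℚ))
                       :- con two :* (c :* (con 1ℚ :+ m) :- con y :* (m :* c))) :* (con 1ℚ :+ (con 1ℚ :+ m)))
       refl c m ⟩
    (four * c * (quarter * (two * m - 1ℚ)) - two * (c * m₁ - y * (m * c))) * m₂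
  ≡⟨ cong₂ (λ u v → (four * c * u - two * (c * m₁ - y * v)) * m₂) coeff₀ below ⟨
    (four * c * (g₀ * m₁) - two * (c * m₁ - y * (cq * m₁))) * m₂
  ≡⟨ solve 5 (λ c g₀ cq m₁ m₂ → (con four :* c :* (g₀ :* m₁) :- con two :* (c :* m₁ :- con y :* (cq :* m₁))) :* m₂
                 := (con four :* (c :* g₀) :- con two :* (c :- con y :* cq)) :* (m₁ :* m₂))
       refl c g₀ cq m₁ m₂ ⟩
    (four * (c * g₀) - two * (c - y * cq)) * (m₁ * m₂) ∎
  where
  m₁ m₂ c₂ : ℚ
  m₁ = 1ℚ + m
  m₂ = 1ℚ + m₁
  c₂ = c * (two * (1ℚ + (m + m)))

cancel-[n+1][n+2] : ∀ n p r →
  p * ((1ℚ + ι n) * (1ℚ + (1ℚ + ι n))) ≡ r * ((1ℚ + ι n) * (1ℚ + (1ℚ + ι n))) → p ≡ r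
cancel-[n+1][n+2] n p r e = *-cancelʳ-ι² p r n (suc n)
  (trans (cong (p *_) denominators) (trans e (cong (r *_) (sym denominators))))
  where
  denominators : ι (suc n) * ι (suc (suc n)) ≡ (1ℚ + ι n) * (1ℚ + (1ℚ + ι n))
  denominators = cong₂ _*_ (ι-suc n) (ι-suc-suc n)

scaledRHS-step : ∀ n →
  scaledRHS (suc n) ≡ four * scaledRHS n - (y ^ℚ n + y ^ℚ n) * (ι ((n ℕ.+ n) C n) - y * ι (belowCentral n))
scaledRHS-step n = begin
    scaledRHS (suc n)
  ≡⟨⟩
    c₁ * (y ^ℚ suc n * g₁) + ι (4 ℕ.^ suc n) * catalanTail (suc n)
  ≡⟨ cong (λ t → c₁ * (y ^ℚ suc n * g₁) + ι (4 ℕ.^ suc n) * t) (catalanTail-step n) ⟩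
    c₁ * ((y * yⁿ) * g₁) + ι (4 ℕ.^ suc n) * (T - cat₁ * qⁿ⁺²)
  ≡⟨ solve 7 (λ c₁ yⁿ g₁ P₁ T cat₁ qq → c₁ :* ((con y :* yⁿ) :* g₁) :+ P₁ :* (T :- cat₁ :* qq)
                 := yⁿ :* (c₁ :* (con y :* g₁)) :+ P₁ :* T :- (P₁ :* qq) :* cat₁)
       refl c₁ yⁿ g₁ (ι (4 ℕ.^ suc n)) T cat₁ qⁿ⁺² ⟩
    yⁿ * (c₁ * (y * g₁)) + ι (4 ℕ.^ suc n) * T - (ι (4 ℕ.^ suc n) * qⁿ⁺²) * cat₁
  ≡⟨ cong₂ (λ u v → yⁿ * (c₁ * (y * g₁)) + u * T - v * cat₁) (ι-* 4 (4 ℕ.^ n)) (power-q n) ⟩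
    yⁿ * (c₁ * (y * g₁)) + (four * P) * T - (yⁿ * (y * q)) * cat₁
  ≡⟨ solve 6 (λ c₁ yⁿ g₁ P T cat₁ → yⁿ :* (c₁ :* (con y :* g₁)) :+ (con four :* P) :* T :- (yⁿ :* (con y :* con q)) :* cat₁
                 := yⁿ :* (c₁ :* (con y :* g₁) :- (con y :* con q) :* cat₁) :+ con four :* (P :* T))
       refl c₁ yⁿ g₁ P T cat₁ ⟩
    yⁿ * (c₁ * (y * g₁) - (y * q) * cat₁) + four * (P * T)
  ≡⟨ cong (λ u → yⁿ * u + four * (P * T)) (cancel-[n+1][n+2] n _ _
       (recurrence-core (ι n) c c₁ cat₁ cq g₀ g₁
         (central-clear n) (catalan-clear n) (belowCentral-clear n) (firstTermCoeff-clear n) coeff₁)) ⟩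
    yⁿ * (four * (c * g₀) - two * (c - y * cq)) + four * (P * T)
  ≡⟨ solve 6 (λ yⁿ c g₀ cq P T → yⁿ :* (con four :* (c :* g₀) :- con two :* (c :- con y :* cq)) :+ con four :* (P :* T)
                 := con four :* (c :* (yⁿ :* g₀) :+ P :* T) :- (yⁿ :+ yⁿ) :* (c :- con y :* cq))
       refl yⁿ c g₀ cq P T ⟩
    four * (c * (yⁿ * g₀) + P * T) - (yⁿ + yⁿ) * (c - y * cq)
  ≡⟨⟩
    four * scaledRHS n - (yⁿ + yⁿ) * (c - y * cq) ∎
  where
  c c₁ cq cat₁ g₀ g₁ yⁿ qⁿ⁺² P T : ℚ
  c = ι ((n ℕ.+ n) C n)
  c₁ = ι ((suc n ℕ.+ suc n) C suc n)
  cq = ι (belowCentral n)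
  cat₁ = catalan (suc n)
  g₀ = firstTermCoeff n
  g₁ = firstTermCoeff (suc n)
  yⁿ = y ^ℚ n
  qⁿ⁺² = q ^ℚ (suc n ℕ.+ 1)
  P = ι (4 ℕ.^ n)
  T = catalanTail n
  coeff₁ : g₁ * (1ℚ + (1ℚ + ι n)) ≡ quarter * (two * (1ℚ + ι n) - 1ℚ)
  coeff₁ = subst (λ u → g₁ * (1ℚ + u) ≡ quarter * (two * u - 1ℚ)) (ι-suc n) (firstTermCoeff-clear (suc n))

-- Both sides agree at n = 0 and satisfy the same recurrence, since (1+y)² = 4.
scaledRHS≡lowerSquareValue : ∀ n → scaledRHS n ≡ lowerSquareValue y n
scaledRHS≡lowerSquareValue zero    = refl
scaledRHS≡lowerSquareValue (suc n) = begin
    scaledRHS (suc n)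
  ≡⟨ scaledRHS-step n ⟩
    four * scaledRHS n - (y ^ℚ n + y ^ℚ n) * e
  ≡⟨ cong (λ u → four * u - (y ^ℚ n + y ^ℚ n) * e) (scaledRHS≡lowerSquareValue n) ⟩
    (1ℚ + y) * (1ℚ + y) * lowerSquareValue y n - (y ^ℚ n + y ^ℚ n) * e
  ≡⟨ lowerSquareValue-step y n ⟨
    lowerSquareValue y (suc n) ∎
  where
  e : ℚ
  e = ι ((n ℕ.+ n) C n) - y * ι (belowCentral n)

summand : ℕ → ℕ → ℕ → ℚ
summand n i j = x ^ℚ (i ℕ.+ j) * frac (ℤ.+ ((n C i) ℕ.* (n C j))) ((i ℕ.+ j) C i)

summand-as-trinomial : ∀ n i j → i < suc n → j < suc n →
  summand n i j ≡ recip ((n ℕ.+ n) C n) * trinomial x (n ℕ.+ n) (n ∸ i) (n ∸ j)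
summand-as-trinomial n i j (s≤s i≤n) (s≤s j≤n) = begin
    x ^ℚ (i ℕ.+ j) * frac (ℤ.+ ((n C i) ℕ.* (n C j))) ((i ℕ.+ j) C i)
  ≡⟨ cong (x ^ℚ (i ℕ.+ j) *_) (frac-cross _ _ _ K (C-pos i j) (C-pos n n) (C-term-regroup n i j i≤n j≤n)) ⟩
    x ^ℚ (i ℕ.+ j) * (recip D * ι K)
  ≡⟨ solve 3 (λ w a b → w :* (a :* b) := a :* (b :* w)) refl (x ^ℚ (i ℕ.+ j)) (recip D) (ι K) ⟩
    recip D * (ι K * x ^ℚ (i ℕ.+ j))
  ≡⟨ cong (λ e → recip D * (ι K * x ^ℚ e)) (reflect-both n i j i≤n j≤n) ⟨
    recip D * trinomial x (n ℕ.+ n) (n ∸ i) (n ∸ j) ∎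
  where
  D K : ℕ
  D = (n ℕ.+ n) C n
  K = ((n ℕ.+ n) C (n ∸ i)) ℕ.* (((n ℕ.+ n) ∸ (n ∸ i)) C (n ∸ j))

lhs≡lowerSquare : ∀ n →
  sumTo n (λ i → sumTo n (summand n i)) ≡ recip ((n ℕ.+ n) C n) * lowerSquare x n
lhs≡lowerSquare n = begin
    sumTo n (λ i → sumTo n (summand n i))
  ≡⟨ trans (sumTo≡sumBelow n (λ i → sumTo n (summand n i))) (sumBelow-cong (suc n) (λ i i≤n →
       trans (sumTo≡sumBelow n (summand n i))
             (sumBelow-cong (suc n) (λ j j≤n → summand-as-trinomial n i j i≤n j≤n)))) ⟩
    sumBelow (suc n) (λ i → sumBelow (suc n) (λ j → recip D * reflected i j))
  ≡⟨ sumBelow-cong (suc n) (λ i _ → sym (sumBelow-*ˡ (suc n) (recip D) (reflected i))) ⟩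
    sumBelow (suc n) (λ i → recip D * sumBelow (suc n) (reflected i))
  ≡⟨ sumBelow-*ˡ (suc n) (recip D) (λ i → sumBelow (suc n) (reflected i)) ⟨
    recip D * sumBelow (suc n) (λ i → sumBelow (suc n) (reflected i))
  ≡⟨ cong (recip D *_) reflect ⟨
    recip D * lowerSquare x n ∎
  where
  D : ℕ
  D = (n ℕ.+ n) C n
  reflected : ℕ → ℕ → ℚ
  reflected i j = trinomial x (n ℕ.+ n) (n ∸ i) (n ∸ j)
  reflect : lowerSquare x n ≡ sumBelow (suc n) (λ i → sumBelow (suc n) (reflected i))
  reflect = trans (sumBelow-reverse (suc n) (λ a → sumBelow (suc n) (trinomial x (n ℕ.+ n) a)))
    (sumBelow-cong (suc n) (λ i _ → sumBelow-reverse (suc n) (trinomial x (n ℕ.+ n) (n ∸ i))))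

unscale : ∀ n → recip ((n ℕ.+ n) C n) * scaledRHS n
  ≡ y ^ℚ n * firstTermCoeff n + frac (ℤ.+ (4 ℕ.^ n)) ((2 ℕ.* n) C n) * catalanTail n
unscale n = begin
    recip D * scaledRHS n
  ≡⟨⟩
    recip D * (ι D * a + ι (4 ℕ.^ n) * catalanTail n)
  ≡⟨ solve 5 (λ r d a p t → r :* (d :* a :+ p :* t) := (r :* d) :* a :+ (p :* r) :* t)
       refl (recip D) (ι D) a (ι (4 ℕ.^ n)) (catalanTail n) ⟩
    (recip D * ι D) * a + (ι (4 ℕ.^ n) * recip D) * catalanTail n
  ≡⟨ cong₂ (λ u v → u * a + v * catalanTail n) (recip-inverse D (C-pos n n)) (sym 4ⁿ/D) ⟩
    1ℚ * a + frac (ℤ.+ (4 ℕ.^ n)) ((2 ℕ.* n) C n) * catalanTail n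
  ≡⟨ cong (_+ frac (ℤ.+ (4 ℕ.^ n)) ((2 ℕ.* n) C n) * catalanTail n) (ℚₚ.*-identityˡ a) ⟩
    a + frac (ℤ.+ (4 ℕ.^ n)) ((2 ℕ.* n) C n) * catalanTail n ∎
  where
  D : ℕ
  D = (n ℕ.+ n) C n
  a : ℚ
  a = y ^ℚ n * firstTermCoeff n
  4ⁿ/D : frac (ℤ.+ (4 ℕ.^ n)) ((2 ℕ.* n) C n) ≡ ι (4 ℕ.^ n) * recip D
  4ⁿ/D = trans (cong (λ k → frac (ℤ.+ (4 ℕ.^ n)) (k C n)) (cong (n ℕ.+_) (ℕₚ.+-identityʳ n)))
               (frac≡*recip (ℤ.+ (4 ℕ.^ n)) D (C-pos n n))

mainTheorem3 : (n : ℕ) →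
    sumTo n (λ i → sumTo n (λ j →
        ((ℤ.- ℤ.+ 4) / 1) ^ℚ (i ℕ.+ j) * frac (ℤ.+ ((n C i) ℕ.* (n C j))) ((i ℕ.+ j) C i)))
    ≡ ((ℤ.- ℤ.+ 3) / 1) ^ℚ n * frac (ℤ.+ (2 ℕ.* n) ℤ.- ℤ.+ 1) (4 ℕ.* (n ℕ.+ 1))
      + frac (ℤ.+ (4 ℕ.^ n)) ((2 ℕ.* n) C n)
        * ((ℤ.+ 1 / 2) - sumTo n (λ k → catalan k * (((ℤ.- ℤ.+ 3) / 4) ^ℚ (k ℕ.+ 1))))
mainTheorem3 n = begin
    sumTo n (λ i → sumTo n (summand n i))
  ≡⟨ lhs≡lowerSquare n ⟩
    recip D * lowerSquare x n
  ≡⟨ cong (recip D *_) (lowerSquare-closedForm x n) ⟩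
    recip D * lowerSquareValue y n
  ≡⟨ cong (recip D *_) (scaledRHS≡lowerSquareValue n) ⟨
    recip D * scaledRHS n
  ≡⟨ unscale n ⟩
    y ^ℚ n * firstTermCoeff n + frac (ℤ.+ (4 ℕ.^ n)) ((2 ℕ.* n) C n) * catalanTail n ∎
  where
  D : ℕ
  D = (n ℕ.+ n) C n
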